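{- For every integer $N\ge 2$, $$ht(N)=1+\max\sum_i k_i\,ht(s_i),$$ where the maximum is over all parameter sets $(N,s_1^{k_1}s_2^{k_2}\cdots)\ne(N,N^1)$ for which an orthogonal array exists, and $ht(s)$ denotes the height of the lattice $\Lambda_s$ (with $ht(1)=0$).
   Context: An orthogonal array $OA(N, s_1^{k_1} s_2^{k_2}\cdots s_v^{k_v})$ (of strength 2) is an $N\times k$ array, $k=k_1+\cdots+k_v$, whose first $k_1$ columns have entries from $\{0,\dots,s_1-1\}$, next $k_2$ columns entries from $\{0,\dots,s_2-1\}$, etc., such that in every $N\times 2$ subarray every possible ordered pair of symbols occurs equally often as a row. Normally $2\le s_1<s_2<\cdots$, $k_i\ge1$; one also allows the trivial $OA(N,1^1)$ (a column of $N$ zeros). The symbol $(N,s_1^{k_1}\cdots)$ is a parameter set; it is realized if such an array exists. Expansive replacement: given an $OA$ with $N$ runs and a column with $S$ levels, and an orthogonal array $B$ with $S$ runs (possibly the trivial $OA(S,1^1)$), replace that column by the rows of $B$ (symbol $j$ by the $j$-th row of $B$); this includes deleting a factor and replacing an $s$-level factor by an $s'$-level one when $s'\mid s$. $P$ is dominated by $Q$ if an array with parameter set $P$ can be obtained from one with parameter set $Q$ by a finite sequence of expansive replacements. $\Lambda_N$ is the set of realized parameter sets with $N$ runs ordered by dominance, a lattice with maximum $(N,N^1)$ and minimum $(N,1^1)$. The height of a node is the number of edges in a longest downward path from it to $(N,1^1)$ in the Hasse diagram; $ht(N)$ is the height of $(N,N^1)$ in $\Lambda_N$. -}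

module Defs where

open import Data.Nat using (ℕ; zero; suc; _+_; _≤_; _≤?_)
open import Data.Nat.Properties using (≤-decTotalOrder)
open import Data.Fin using (Fin; _≟_)
open import Data.Bool using (Bool; true; false; _∧_)
open import Data.List using (List; []; _∷_; _++_; map; filter; length; lookup)
open import Data.List.Relation.Unary.All using (All)
open import Data.Product using (Σ; ∃; ∃-syntax; _×_; _,_)
open import Data.Sum using (_⊎_)
open import Relation.Nullary using (¬_; does)
open import Relation.Binary.PropositionalEquality using (_≡_; _≢_)
open import Relation.Binary.Construct.Closure.ReflexiveTransitive using (Star)
import Data.List.Sort.MergeSort.Base as MS

record Column (N : ℕ) : Set where
  constructor mkCol
  field
    level   : ℕ
    entries : Fin N → Fin level

open Column public

Array : ℕ → Set
Array N = List (Column N)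

count : ∀ {N : ℕ} → (Fin N → Bool) → ℕ
count {zero}  p = 0
count {suc N} p = (if p Fin.zero then 1 else 0) + count {N} (λ r → p (Fin.suc r))
  where open import Data.Bool using (if_then_else_)
        import Data.Fin as Fin

Balanced₁ : ∀ {N} → Column N → Set
Balanced₁ {N} c =
  ∀ (a a′ : Fin (level c)) →
    count (λ r → does (entries c r ≟ a)) ≡ count (λ r → does (entries c r ≟ a′))

Balanced₂ : ∀ {N} → Column N → Column N → Set
Balanced₂ {N} c d =
  ∀ (a a′ : Fin (level c)) (b b′ : Fin (level d)) →
    count (λ r → does (entries c r ≟ a) ∧ does (entries d r ≟ b))
      ≡ count (λ r → does (entries c r ≟ a′) ∧ does (entries d r ≟ b′))

-- orthogonal array of strength 2 (single columns are required to be
-- balanced as well, as is standard; this is implied by strength 2 as soon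
-- as there are at least two columns)
IsOA : ∀ {N} → Array N → Set
IsOA {N} A =
  All Balanced₁ A ×
  (∀ (i j : Fin (length A)) → i ≢ j → Balanced₂ (lookup A i) (lookup A j))

-- A parameter set (N, s₁^{k₁} s₂^{k₂} ⋯) with 2 ≤ s₁ < s₂ < ⋯ is encoded
-- (for fixed N) as the non-decreasing list of the column levels, i.e. the
-- list s₁ (k₁ times), s₂ (k₂ times), … .  The trivial parameter set
-- (N, 1^1) is encoded by the empty list (one-level columns are constant
-- columns, i.e. deleted factors).

ParamSet : Set
ParamSet = List ℕ

sortℕ : List ℕ → List ℕ
sortℕ = MS.sort ≤-decTotalOrder

params : ∀ {N} → Array N → ParamSet
params A = sortℕ (filter (2 ≤?_) (map level A))

Realized : ℕ → ParamSet → Set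
Realized N P = Σ (Array N) λ A → IsOA A × params A ≡ P

top : ℕ → ParamSet
top N = N ∷ []

bottom : ParamSet
bottom = []

-- Expansive replacement: a column c (with S = level c levels) of an array
-- with N runs is replaced by the columns of an orthogonal array B with S runs,
-- symbol j being replaced by the j-th row of B.

replaceCol : ∀ {N} (c : Column N) → Array (level c) → Array N
replaceCol c B = map (λ d → mkCol (level d) (λ r → entries d (entries c r))) B

data ExpRepl {N : ℕ} : Array N → Array N → Set where
  repl : (pre : Array N) (c : Column N) (post : Array N)
         (B : Array (level c)) → IsOA B →
         ExpRepl (pre ++ c ∷ post) (pre ++ replaceCol c B ++ post)

Dominated : (N : ℕ) → ParamSet → ParamSet → Set
Dominated N P Q =
  Σ (Array N) λ A → IsOA A × params A ≡ Q ×
  Σ (Array N) λ A′ → params A′ ≡ P × Star (ExpRepl {N}) A A′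

Covers : ℕ → ParamSet → ParamSet → Set
Covers N P Q =
  Realized N P × Realized N Q × Dominated N P Q × P ≢ Q ×
  (∀ R → Realized N R → Dominated N P R → Dominated N R Q → R ≡ P ⊎ R ≡ Q)

data DownPath (N : ℕ) : ParamSet → ℕ → Set where
  atBottom : DownPath N bottom 0
  step     : ∀ {P Q n} → Covers N P Q → DownPath N P n → DownPath N Q (suc n)

HeightOf : ℕ → ParamSet → ℕ → Set
HeightOf N Q h = DownPath N Q h × (∀ n → DownPath N Q n → n ≤ h)

Ht : ℕ → ℕ → Set
Ht s h = HeightOf s (top s) h

data SumHt : ParamSet → ℕ → Set where
  []  : SumHt [] 0
  _∷_ : ∀ {s h ss m} → Ht s h → SumHt ss m → SumHt (s ∷ ss) (h + m)

IsMaxSumHt : ℕ → ℕ → Set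
IsMaxSumHt N m =
  (∃[ P ] (Realized N P × P ≢ top N × SumHt P m)) ×
  (∀ P m′ → Realized N P → P ≢ top N → SumHt P m′ → m′ ≤ m)

-- Write weight P = Σ kᵢ ht(sᵢ). By induction on N, every realized (s, …) ≠ (s, s¹) with s < N
-- has weight at most ht(s) − 1. So replacing an s-level column of an orthogonal array by an
-- array B with s runs either leaves the parameter set unchanged (s ≤ 1, or B of type (s, s¹)) or
-- lowers the weight, and a downward path from P ≠ (N, N¹) has at most weight P edges.
-- Conversely, replacing a column by an array of maximal weight lowers the weight by exactly one;
-- nothing realized fits strictly in between, so the step is a covering, and iterating it gives a
-- path of length weight P. Hence ht(N) = 1 + max weight P over realized P ≠ (N, N¹). The maximum
-- exists because an orthogonal array with N runs has at most N^N distinct non-constant columns,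
-- so its parameter sets can be searched exhaustively.

module Submission where

open import Defs

open import Data.Bool using (Bool; true; false; _∧_; if_then_else_; T)
open import Data.Bool.Properties using (∧-identityʳ; ∧-comm; T-∧)
open import Data.Empty using (⊥-elim)
open import Data.Fin
  using (Fin; zero; suc; toℕ; _≟_; fromℕ<; cast; inject≤; remQuot; combine; punchIn; funToFin; finToFun)
open import Data.Fin.Properties as Fin
  using ( all?; injective⇒≤; toℕ-injective; toℕ-fromℕ<; toℕ-cast; toℕ-inject≤; combine-remQuot
        ; punchInᵢ≢i; finToFun-funToFin)
open import Data.List using (List; []; _∷_; _++_; map; lookup; length; filter)
open import Data.List.Properties
  using ( ≡-dec; ++-identityʳ; length-map; map-++; map-∘; filter-++; filter-accept; filter-reject
        ; filter-none)
open import Data.List.Membership.Propositional using (find)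
open import Data.List.Membership.Propositional.Properties using (∈-lookup; ∈-∃++)
open import Data.List.Relation.Binary.Permutation.Propositional using (_↭_; ↭-sym)
import Data.List.Relation.Binary.Permutation.Propositional.Properties as ↭
open import Data.List.Relation.Binary.Pointwise as Pointwise
  using (Pointwise; []; _∷_; Pointwise-length; Pointwise-≡⇒≡)
open import Data.List.Relation.Binary.Pointwise.Properties using (symmetric)
open import Data.List.Relation.Unary.All as All using (All; []; _∷_)
import Data.List.Relation.Unary.All.Properties as All
open import Data.List.Relation.Unary.AllPairs as AllPairs using (AllPairs; []; _∷_; allPairs?)
import Data.List.Relation.Unary.AllPairs.Properties as AllPairs
open import Data.List.Relation.Unary.Any as Any using (Any; here; there; any?)
import Data.List.Sort.MergeSort.Properties as MergeSort
open import Data.Nat as ℕ using (ℕ; zero; suc; _+_; _*_; _^_; _≤_; _<_; z≤n; s≤s; _≤?_; _<?_; >-nonZero)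
open import Data.Nat.Induction using (<-rec)
open import Data.Nat.ListAction using (sum)
open import Data.Nat.ListAction.Properties using (sum-++; sum-↭)
open import Data.Nat.Properties
  using ( ≤-refl; ≤-trans; ≤-antisym; ≤-total; ≤-<-trans; <-trans; <-irrefl; ≤-pred; <⇒≤; ≮⇒≥
        ; ≤∧≢⇒<; <⇒≱; ≤⇒≯; m<n⇒m<1+n; m≤n+m; 0≢1+n; 1+n≢n; suc-injective; +-identityʳ; +-suc
        ; +-monoʳ-<; +-monoˡ-<; *-identityˡ; *-identityʳ; *-assoc; *-comm; *-cancelˡ-≤
        ; +-*-semiring; ≤-decTotalOrder; module ≤-Reasoning)
open import Algebra.Properties.Semiring.Sum +-*-semiring
  using (sum-syntax; sum-cong-≗; ∑-comm; *-distribˡ-sum; *-distribʳ-sum; sum-replicate-zero)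
open import Data.Product using (Σ; ∃-syntax; _×_; _,_; proj₁; proj₂; uncurry)
open import Data.Sum using (_⊎_; inj₁; inj₂)
open import Data.Vec as Vec using (Vec; []; _∷_; tabulate)
open import Data.Vec.Properties using (lookup∘tabulate)
open import Function using (_∘_; Equivalence)
open import Relation.Binary using (Rel; Symmetric)
open import Relation.Binary.Construct.Closure.ReflexiveTransitive using (Star; ε; _◅_)
open import Relation.Binary.PropositionalEquality
open import Relation.Nullary using (¬_; Dec; yes; no; does; contradiction)
open import Relation.Nullary.Decidable using (_×-dec_; toWitness; fromWitness; isYes≗does; does-≡; map′)
open import Relation.Unary using (Pred)

m*n≤m⇒n≤1 : ∀ {m n} → 0 < m → m * n ≤ m → n ≤ 1
m*n≤m⇒n≤1 {m} 0<m mn≤m = *-cancelˡ-≤ m {{>-nonZero 0<m}} (subst (m * _ ≤_) (sym (*-identityʳ m)) mn≤m)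

∃-≢ : ∀ {n} → 2 ≤ n → (b : Fin n) → ∃[ b′ ] b′ ≢ b
∃-≢ (s≤s (s≤s _)) b = punchIn b zero , punchInᵢ≢i b zero

module _ {a} {A : Set a} where

  lookup⇒All : ∀ {p} {P : Pred A p} {xs : List A} → (∀ i → P (lookup xs i)) → All P xs
  lookup⇒All {xs = []}     _        = []
  lookup⇒All {xs = x ∷ xs} P-lookup = P-lookup zero ∷ lookup⇒All (P-lookup ∘ suc)

  lookup⇒AllPairs : ∀ {ℓ} {R : Rel A ℓ} {xs : List A} →
    (∀ i j → i ≢ j → R (lookup xs i) (lookup xs j)) → AllPairs R xs
  lookup⇒AllPairs {xs = []}     _        = []
  lookup⇒AllPairs {xs = x ∷ xs} R-lookup =
    lookup⇒All (λ j → R-lookup zero (suc j) (λ ())) ∷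
    lookup⇒AllPairs (λ i j i≢j → R-lookup (suc i) (suc j) (i≢j ∘ Fin.suc-injective))

  AllPairs⇒lookup : ∀ {ℓ} {R : Rel A ℓ} → Symmetric R → {xs : List A} → AllPairs R xs →
    ∀ i j → i ≢ j → R (lookup xs i) (lookup xs j)
  AllPairs⇒lookup sym-R (_   ∷ _)   zero    zero    i≢j = ⊥-elim (i≢j refl)
  AllPairs⇒lookup sym-R (Rx  ∷ _)   zero    (suc j) _   = All.lookup Rx (∈-lookup j)
  AllPairs⇒lookup sym-R (Rx  ∷ _)   (suc i) zero    _   = sym-R (All.lookup Rx (∈-lookup i))
  AllPairs⇒lookup sym-R (_   ∷ Rxs) (suc i) (suc j) i≢j = AllPairs⇒lookup sym-R Rxs i j (i≢j ∘ cong suc)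

  All-replace : ∀ {p} {P : Pred A p} (pre : List A) {x : A} {post ys : List A} →
    All P (pre ++ x ∷ post) → All P ys → All P (pre ++ ys ++ post)
  All-replace pre P-all P-ys with All.++⁻ pre P-all
  ... | P-pre , _ ∷ P-post = All.++⁺ P-pre (All.++⁺ P-ys P-post)

  AllPairs-replace : ∀ {ℓ} {R : Rel A ℓ} → Symmetric R → (pre : List A) {x : A} {post ys : List A} →
    AllPairs R (pre ++ x ∷ post) → AllPairs R ys → (∀ {z} → R x z → All (λ y → R y z) ys) →
    AllPairs R (pre ++ ys ++ post)
  AllPairs-replace sym-R [] (Rx-post ∷ R-post) R-ys inherit =
    AllPairs.++⁺ R-ys R-post (All.All-swap (All.map inherit Rx-post))
  AllPairs-replace {R = R} sym-R (w ∷ pre) {post = post} {ys} (Rw ∷ R-rest) R-ys inherit =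
    Rw′ ∷ AllPairs-replace sym-R pre R-rest R-ys inherit
    where
      Rw′ : All (R w) (pre ++ ys ++ post)
      Rw′ with All.++⁻ pre Rw
      ... | Rw-pre , Rwx ∷ Rw-post = All.++⁺ Rw-pre (All.++⁺ (All.map sym-R (inherit (sym-R Rwx))) Rw-post)

-- Counting rows

ind : Bool → ℕ
ind b = if b then 1 else 0

ind-∧ : ∀ a b → ind (a ∧ b) ≡ ind a * ind b
ind-∧ false b = refl
ind-∧ true  b = sym (+-identityʳ (ind b))

count-cong : ∀ {N} {p q : Fin N → Bool} → (∀ r → p r ≡ q r) → count p ≡ count q
count-cong {zero}  eq = refl
count-cong {suc N} eq = cong₂ _+_ (cong ind (eq zero)) (count-cong (eq ∘ suc))

count-∑ : ∀ {N} (p : Fin N → Bool) → count p ≡ ∑[ r < N ] ind (p r)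
count-∑ {zero}  p = refl
count-∑ {suc N} p = cong (ind (p zero) +_) (count-∑ (p ∘ suc))

count-∧-true : ∀ {N} (p : Fin N → Bool) → count p ≡ count (λ r → p r ∧ true)
count-∧-true p = count-cong (λ r → sym (∧-identityʳ (p r)))

count>0⇒∃ : ∀ {N} (p : Fin N → Bool) → 0 < count p → ∃[ r ] T (p r)
count>0⇒∃ {suc N} p pos with p zero in eq
... | true  = zero , subst T (sym eq) _
... | false = let r , pr = count>0⇒∃ (p ∘ suc) pos in suc r , pr

∃⇒count>0 : ∀ {N} (p : Fin N → Bool) (r : Fin N) → T (p r) → 0 < count p
∃⇒count>0 p zero    pr with true ← p zero = s≤s z≤n
∃⇒count>0 p (suc r) pr = ≤-trans (∃⇒count>0 (p ∘ suc) r pr) (m≤n+m _ _)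

∑-δ : ∀ {n} (y : Fin n) (h : Fin n → ℕ) → ∑[ x < n ] (ind (does (y ≟ x)) * h x) ≡ h y
∑-δ {suc n} zero    h = trans (cong₂ _+_ (*-identityˡ (h zero)) (sum-replicate-zero n)) (+-identityʳ (h zero))
∑-δ {suc n} (suc y) h = ∑-δ y (h ∘ suc)

carries : ∀ {N} (c : Column N) → Fin (level c) → Fin N → Bool
carries c x r = does (entries c r ≟ x)

carries⇒≡ : ∀ {N} (c : Column N) {x r} → T (carries c x r) → entries c r ≡ x
carries⇒≡ c {x} {r} t = toWitness (subst T (sym (isYes≗does (entries c r ≟ x))) t)

≡⇒carries : ∀ {N} (c : Column N) {x r} → entries c r ≡ x → T (carries c x r)
≡⇒carries c {x} {r} eq = subst T (isYes≗does (entries c r ≟ x)) (fromWitness eq)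

count-fibres : ∀ {N} (c : Column N) (p : Fin (level c) → Bool) (q : Fin N → Bool) →
  count (λ r → p (entries c r) ∧ q r) ≡ ∑[ x < level c ] (ind (p x) * count (λ r → carries c x r ∧ q r))
count-fibres {N} c p q = begin
  count (λ r → p (entries c r) ∧ q r)
    ≡⟨ count-∑ (λ r → p (entries c r) ∧ q r) ⟩
  ∑[ r < N ] ind (p (entries c r) ∧ q r)
    ≡⟨ sum-cong-≗ (λ r → trans (ind-∧ (p (entries c r)) (q r))
                               (sym (∑-δ (entries c r) (λ x → ind (p x) * ind (q r))))) ⟩
  ∑[ r < N ] ∑[ x < level c ] (ind (carries c x r) * (ind (p x) * ind (q r)))
    ≡⟨ ∑-comm (λ r x → ind (carries c x r) * (ind (p x) * ind (q r))) ⟩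
  ∑[ x < level c ] ∑[ r < N ] (ind (carries c x r) * (ind (p x) * ind (q r)))
    ≡⟨ sum-cong-≗ (λ x → sum-cong-≗ (λ r → rearrange (carries c x r) (p x) (q r))) ⟩
  ∑[ x < level c ] ∑[ r < N ] (ind (p x) * ind (carries c x r ∧ q r))
    ≡⟨ sum-cong-≗ (λ x → sym (trans (cong (ind (p x) *_) (count-∑ (λ r → carries c x r ∧ q r)))
                                    (*-distribˡ-sum (ind (p x)) (λ r → ind (carries c x r ∧ q r))))) ⟩
  ∑[ x < level c ] (ind (p x) * count (λ r → carries c x r ∧ q r))
    ∎
  where
    open ≡-Reasoning
    rearrange : ∀ a b d → ind a * (ind b * ind d) ≡ ind b * ind (a ∧ d)
    rearrange a b d = begin
      ind a * (ind b * ind d) ≡⟨ sym (*-assoc (ind a) _ _) ⟩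
      ind a * ind b * ind d   ≡⟨ cong (_* ind d) (*-comm (ind a) _) ⟩
      ind b * ind a * ind d   ≡⟨ *-assoc (ind b) _ _ ⟩
      ind b * (ind a * ind d) ≡⟨ cong (ind b *_) (sym (ind-∧ a d)) ⟩
      ind b * ind (a ∧ d)     ∎

∑-ind-* : ∀ {n} (p : Fin n → Bool) (k : ℕ) → ∑[ x < n ] (ind (p x) * k) ≡ count p * k
∑-ind-* p k = sym (trans (cong (_* k) (count-∑ p)) (*-distribʳ-sum k (λ x → ind (p x))))

∑-ind-*-cong : ∀ {n} {p p′ : Fin n → Bool} {g g′ : Fin n → ℕ} →
  count p ≡ count p′ → (∀ x x′ → g x ≡ g′ x′) →
  ∑[ x < n ] (ind (p x) * g x) ≡ ∑[ x < n ] (ind (p′ x) * g′ x)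
∑-ind-*-cong {zero}                      _   _     = refl
∑-ind-*-cong {suc n} {p} {p′} {g} {g′} p≡p′ g≡g′ = begin
  ∑[ x < suc n ] (ind (p x) * g x)        ≡⟨ sum-cong-≗ (λ x → cong (ind (p x) *_) (g≡g′ x zero)) ⟩
  ∑[ x < suc n ] (ind (p x) * g′ zero)    ≡⟨ ∑-ind-* p _ ⟩
  count p * g′ zero                       ≡⟨ cong (_* g′ zero) p≡p′ ⟩
  count p′ * g′ zero                      ≡⟨ sym (∑-ind-* p′ _) ⟩
  ∑[ x < suc n ] (ind (p′ x) * g′ zero)
    ≡⟨ sum-cong-≗ (λ x → cong (ind (p′ x) *_) (trans (sym (g≡g′ zero zero)) (g≡g′ zero x))) ⟩
  ∑[ x < suc n ] (ind (p′ x) * g′ x)      ∎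
  where open ≡-Reasoning

count-pullback-cong : ∀ {N} (c : Column N) {p p′ : Fin (level c) → Bool} {q q′ : Fin N → Bool} →
  count p ≡ count p′ →
  (∀ x x′ → count (λ r → carries c x r ∧ q r) ≡ count (λ r → carries c x′ r ∧ q′ r)) →
  count (λ r → p (entries c r) ∧ q r) ≡ count (λ r → p′ (entries c r) ∧ q′ r)
count-pullback-cong c {p} {p′} {q} {q′} p≡p′ fibres≡ =
  trans (count-fibres c p q) (trans (∑-ind-*-cong p≡p′ fibres≡) (sym (count-fibres c p′ q′)))

count-pullback-cong₁ : ∀ {N} {c : Column N} {p p′ : Fin (level c) → Bool} →
  Balanced₁ c → count p ≡ count p′ → count (p ∘ entries c) ≡ count (p′ ∘ entries c)
count-pullback-cong₁ {c = c} {p} {p′} bc p≡p′ =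
  trans (count-∧-true (p ∘ entries c))
  (trans (count-pullback-cong c p≡p′ fibres≡) (sym (count-∧-true (p′ ∘ entries c))))
  where
    fibres≡ : ∀ x x′ → count (λ r → carries c x r ∧ true) ≡ count (λ r → carries c x′ r ∧ true)
    fibres≡ x x′ = trans (sym (count-∧-true (carries c x))) (trans (bc x x′) (count-∧-true (carries c x′)))

-- Balanced columns and expansive replacement

symbol-occurs : ∀ {N} (c : Column N) → Fin N → Balanced₁ c → ∀ a → ∃[ r ] entries c r ≡ a
symbol-occurs c r₀ bc a =
  let r₀-counted = ∃⇒count>0 _ r₀ (≡⇒carries c refl)
      r , carried = count>0⇒∃ (carries c a) (subst (0 <_) (bc (entries c r₀) a) r₀-counted)
  in r , carries⇒≡ c carried

pair-occurs : ∀ {N} (c d : Column N) → Fin N → Balanced₂ c d →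
  ∀ a b → ∃[ r ] (entries c r ≡ a × entries d r ≡ b)
pair-occurs c d r₀ bcd a b =
  let r , carried = count>0⇒∃ (λ r → carries c a r ∧ carries d b r)
                              (subst (0 <_) (bcd (entries c r₀) a (entries d r₀) b) r₀-counted)
      ca , db = Equivalence.to (T-∧ {carries c a r}) carried
  in r , carries⇒≡ c ca , carries⇒≡ d db
  where
    r₀-counted : 0 < count (λ r → carries c (entries c r₀) r ∧ carries d (entries d r₀) r)
    r₀-counted = ∃⇒count>0 _ r₀ (Equivalence.from T-∧ (≡⇒carries c refl , ≡⇒carries d refl))

level≤runs : ∀ {N} (c : Column N) → Fin N → Balanced₁ c → level c ≤ N
level≤runs {N} c r₀ bc = injective⇒≤ {f = row} injective
  where
    row : Fin (level c) → Fin N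
    row = proj₁ ∘ symbol-occurs c r₀ bc
    injective : ∀ {a a′} → row a ≡ row a′ → a ≡ a′
    injective {a} {a′} eq = trans (sym (proj₂ (symbol-occurs c r₀ bc a)))
                                  (trans (cong (entries c) eq) (proj₂ (symbol-occurs c r₀ bc a′)))

level*level≤runs : ∀ {N} (c d : Column N) → Fin N → Balanced₂ c d → level c * level d ≤ N
level*level≤runs {N} c d r₀ bcd = injective⇒≤ {f = row} injective
  where
    symbols : Fin (level c * level d) → Fin (level c) × Fin (level d)
    symbols = remQuot (level d)
    row : Fin (level c * level d) → Fin N
    row = proj₁ ∘ uncurry (pair-occurs c d r₀ bcd) ∘ symbols
    symbols-row : ∀ i → (entries c (row i) , entries d (row i)) ≡ symbols i
    symbols-row i = let _ , c≡ , d≡ = uncurry (pair-occurs c d r₀ bcd) (symbols i) in cong₂ _,_ c≡ d≡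
    injective : ∀ {i j} → row i ≡ row j → i ≡ j
    injective {i} {j} eq = begin
      i                          ≡⟨ sym (combine-remQuot {level c} (level d) i) ⟩
      uncurry combine (symbols i) ≡⟨ cong (uncurry combine) (trans (sym (symbols-row i))
                                      (trans (cong (λ r → entries c r , entries d r) eq) (symbols-row j))) ⟩
      uncurry combine (symbols j) ≡⟨ combine-remQuot {level c} (level d) j ⟩
      j                          ∎
      where open ≡-Reasoning

balanced₂⇒¬≗ : ∀ {N} (c d : Column N) → Fin N → Balanced₂ c d → 2 ≤ level d →
  ¬ (∀ r → toℕ (entries c r) ≡ toℕ (entries d r))
balanced₂⇒¬≗ c d r₀ bcd 2≤d c≗d =
  let b , b≢d₀ = ∃-≢ 2≤d (entries d r₀)
      r , c≡c₀ , d≡b = pair-occurs c d r₀ bcd (entries c r₀) b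
  in b≢d₀ (toℕ-injective (begin
       toℕ b             ≡⟨ cong toℕ (sym d≡b) ⟩
       toℕ (entries d r) ≡⟨ sym (c≗d r) ⟩
       toℕ (entries c r) ≡⟨ cong toℕ c≡c₀ ⟩
       toℕ (entries c r₀) ≡⟨ c≗d r₀ ⟩
       toℕ (entries d r₀) ∎))
  where open ≡-Reasoning

balanced₂-sym : ∀ {N} {c d : Column N} → Balanced₂ c d → Balanced₂ d c
balanced₂-sym {c = c} {d} bcd a a′ b b′ =
  trans (count-cong (λ r → ∧-comm (carries d a r) (carries c b r)))
  (trans (bcd b b′ a a′) (count-cong (λ r → ∧-comm (carries c b′ r) (carries d a′ r))))

pullback : ∀ {N} (c : Column N) → Column (level c) → Column N
pullback c d = mkCol (level d) (entries d ∘ entries c)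

balanced₁-pullback : ∀ {N} {c : Column N} {d : Column (level c)} →
  Balanced₁ c → Balanced₁ d → Balanced₁ (pullback c d)
balanced₁-pullback {c = c} bc bd a a′ = count-pullback-cong₁ {c = c} bc (bd a a′)

balanced₂-pullback : ∀ {N} {c : Column N} {d d′ : Column (level c)} →
  Balanced₁ c → Balanced₂ d d′ → Balanced₂ (pullback c d) (pullback c d′)
balanced₂-pullback {c = c} bc bdd′ a a′ b b′ = count-pullback-cong₁ {c = c} bc (bdd′ a a′ b b′)

balanced₂-pullbackˡ : ∀ {N} {c e : Column N} {d : Column (level c)} →
  Balanced₂ c e → Balanced₁ d → Balanced₂ (pullback c d) e
balanced₂-pullbackˡ {c = c} bce bd a a′ b b′ = count-pullback-cong c (bd a a′) (λ x x′ → bce x x′ b b′)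

balanced₁? : ∀ {N} (c : Column N) → Dec (Balanced₁ c)
balanced₁? c = all? λ a → all? λ a′ → count (carries c a) ℕ.≟ count (carries c a′)

balanced₂? : ∀ {N} (c d : Column N) → Dec (Balanced₂ c d)
balanced₂? c d = all? λ a → all? λ a′ → all? λ b → all? λ b′ →
  count (λ r → carries c a r ∧ carries d b r) ℕ.≟ count (λ r → carries c a′ r ∧ carries d b′ r)

-- IsOA with the pairwise condition as AllPairs, which is stable under the list surgery of
-- expansive replacement.
IsOA′ : ∀ {N} → Array N → Set
IsOA′ A = All Balanced₁ A × AllPairs Balanced₂ A

IsOA⇒IsOA′ : ∀ {N} {A : Array N} → IsOA A → IsOA′ A
IsOA⇒IsOA′ (b₁ , b₂) = b₁ , lookup⇒AllPairs b₂

IsOA′⇒IsOA : ∀ {N} {A : Array N} → IsOA′ A → IsOA A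
IsOA′⇒IsOA (b₁ , b₂) = b₁ , AllPairs⇒lookup (λ {c} {d} → balanced₂-sym {c = c} {d}) b₂

IsOA′? : ∀ {N} (A : Array N) → Dec (IsOA′ A)
IsOA′? A = All.all? balanced₁? A ×-dec allPairs? balanced₂? A

IsOA′-replace : ∀ {N} (pre : Array N) {c : Column N} {post : Array N} {B : Array (level c)} →
  IsOA′ (pre ++ c ∷ post) → IsOA′ B → IsOA′ (pre ++ replaceCol c B ++ post)
IsOA′-replace pre {c} (b₁ , b₂) (b₁B , b₂B) with All.++⁻ʳ pre b₁
... | bc ∷ _ =
  All-replace pre b₁ (All.map⁺ (All.map (λ {d} → balanced₁-pullback {c = c} {d} bc) b₁B)) ,
  AllPairs-replace (λ {d} {e} → balanced₂-sym {c = d} {e}) pre b₂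
    (AllPairs.map⁺ (AllPairs.map (λ {d} {d′} → balanced₂-pullback {c = c} {d} {d′} bc) b₂B))
    (λ {e} bce → All.map⁺ (All.map (λ {d} → balanced₂-pullbackˡ {c = c} {e} {d} bce) b₁B))

identityColumn : ∀ N → Column N
identityColumn N = mkCol N (λ r → r)

count-≟ : ∀ {N} (a : Fin N) → count (λ r → does (r ≟ a)) ≡ 1
count-≟ {N} a = begin
  count (λ r → does (r ≟ a))         ≡⟨ count-∑ (λ r → does (r ≟ a)) ⟩
  ∑[ r < N ] ind (does (r ≟ a))
    ≡⟨ sum-cong-≗ (λ r → trans (cong ind (does-≡ (r ≟ a) (map′ sym sym (a ≟ r)))) (sym (*-identityʳ _))) ⟩
  ∑[ r < N ] (ind (does (a ≟ r)) * 1) ≡⟨ ∑-δ a (λ _ → 1) ⟩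
  1                                   ∎
  where open ≡-Reasoning

IsOA′-identityColumn : ∀ N → IsOA′ (identityColumn N ∷ [])
IsOA′-identityColumn N = (λ a a′ → trans (count-≟ a) (sym (count-≟ a′))) ∷ [] , [] ∷ []

-- Parameter sets

levels : ∀ {N} → Array N → List ℕ
levels A = filter (2 ≤?_) (map level A)

levels-++ : ∀ {N} (A B : Array N) → levels (A ++ B) ≡ levels A ++ levels B
levels-++ A B = trans (cong (filter (2 ≤?_)) (map-++ level A B)) (filter-++ (2 ≤?_) (map level A) (map level B))

levels-infix : ∀ {N} (pre ys post : Array N) → levels (pre ++ ys ++ post) ≡ levels pre ++ levels ys ++ levels post
levels-infix pre ys post = trans (levels-++ pre (ys ++ post)) (cong (levels pre ++_) (levels-++ ys post))

levels-replaceCol : ∀ {N} (c : Column N) (B : Array (level c)) → levels (replaceCol c B) ≡ levels B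
levels-replaceCol c B = cong (filter (2 ≤?_)) (sym (map-∘ B))

levels-∷-accept : ∀ {N} (c : Column N) (A : Array N) → 2 ≤ level c → levels (c ∷ A) ≡ level c ∷ levels A
levels-∷-accept c A = filter-accept (2 ≤?_)

levels-∷-reject : ∀ {N} (c : Column N) (A : Array N) → level c ≤ 1 → levels (c ∷ A) ≡ levels A
levels-∷-reject c A c≤1 = filter-reject (2 ≤?_) (≤⇒≯ c≤1)

levels-constant : ∀ {N} {A : Array N} → All (λ c → level c ≤ 1) A → levels A ≡ []
levels-constant small = filter-none (2 ≤?_) (All.map⁺ (All.map ≤⇒≯ small))

nonconstant? : ∀ {N} (c : Column N) → Dec (2 ≤ level c)
nonconstant? c = 2 ≤? level c

levels-nonconstant : ∀ {N} (A : Array N) → levels (filter nonconstant? A) ≡ levels A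
levels-nonconstant []      = refl
levels-nonconstant (c ∷ A) = by-cases (nonconstant? c)
  where
    open ≡-Reasoning
    by-cases : Dec (2 ≤ level c) → levels (filter nonconstant? (c ∷ A)) ≡ levels (c ∷ A)
    by-cases (yes 2≤c) = begin
      levels (filter nonconstant? (c ∷ A))  ≡⟨ cong levels (filter-accept nonconstant? 2≤c) ⟩
      levels (c ∷ filter nonconstant? A)    ≡⟨ levels-∷-accept c _ 2≤c ⟩
      level c ∷ levels (filter nonconstant? A) ≡⟨ cong (level c ∷_) (levels-nonconstant A) ⟩
      level c ∷ levels A                    ≡⟨ sym (levels-∷-accept c A 2≤c) ⟩
      levels (c ∷ A)                        ∎
    by-cases (no 2≰c) = begin
      levels (filter nonconstant? (c ∷ A))  ≡⟨ cong levels (filter-reject nonconstant? 2≰c) ⟩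
      levels (filter nonconstant? A)        ≡⟨ levels-nonconstant A ⟩
      levels A                              ≡⟨ sym (levels-∷-reject c A (≮⇒≥ 2≰c)) ⟩
      levels (c ∷ A)                        ∎

nonconstant-split : ∀ {N} (A : Array N) →
  All (λ c → level c ≤ 1) A ⊎
  Σ (Array N) λ pre → Σ (Column N) λ c → Σ (Array N) λ post → A ≡ pre ++ c ∷ post × 2 ≤ level c
nonconstant-split A with any? nonconstant? A
... | no  none = inj₁ (All.map ≮⇒≥ (All.¬Any⇒All¬ A none))
... | yes some =
  let c , c∈A , 2≤c = find some
      pre , post , A≡ = ∈-∃++ c∈A
  in inj₂ (pre , c , post , A≡ , 2≤c)

LevelsBelow : ∀ {N} → ℕ → Array N → Set
LevelsBelow M A = All (λ c → level c < M) A

All-params : ∀ {N} {q} {Q : Pred ℕ q} {A : Array N} → All (Q ∘ level) A → All (λ s → 2 ≤ s × Q s) (params A)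
All-params {A = A} Q-A =
  ↭.All-resp-↭ (↭-sym (MergeSort.sort-↭ ≤-decTotalOrder (levels A)))
    (All.zipWith (λ (2≤s , Qs) → 2≤s , Qs)
                 (All.all-filter (2 ≤?_) (map level A) , All.filter⁺ (2 ≤?_) (All.map⁺ Q-A)))

params≢top : ∀ {N} {A : Array N} → LevelsBelow N A → params A ≢ top N
params≢top small eq with subst (All _) eq (All-params small)
... | (_ , N<N) ∷ [] = <-irrefl refl N<N

full-column⇒levels≡ : ∀ {M} → Fin M → 2 ≤ M → {A : Array M} → IsOA′ A →
  Any (λ c → level c ≡ M) A → levels A ≡ M ∷ []
full-column⇒levels≡ {M} r₀ 2≤M {c ∷ A} (_ , bc ∷ _) (here refl) =
  trans (levels-∷-accept c A 2≤M)
        (cong (_ ∷_) (levels-constant (All.map (λ {d} bcd → m*n≤m⇒n≤1 0<M (level*level≤runs c d r₀ bcd)) bc)))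
  where
    0<M : 0 < M
    0<M = ≤-trans (s≤s z≤n) 2≤M
full-column⇒levels≡ {M} r₀ 2≤M {c ∷ A} (_ ∷ b₁ , bc ∷ b₂) (there full) =
  let bcd , d≡M = All.lookupAny bc full
      cM≤M = subst (λ m → level c * m ≤ M) d≡M (level*level≤runs c (Any.lookup full) r₀ bcd)
  in trans (levels-∷-reject c A (m*n≤m⇒n≤1 0<M (subst (_≤ M) (*-comm (level c) M) cM≤M)))
           (full-column⇒levels≡ r₀ 2≤M {A} (b₁ , b₂) full)
  where
    0<M : 0 < M
    0<M = ≤-trans (s≤s z≤n) 2≤M

params≢top⇒levels<runs : ∀ {M} → Fin M → 2 ≤ M → {A : Array M} → IsOA′ A →
  params A ≢ top M → LevelsBelow M A
params≢top⇒levels<runs {M} r₀ 2≤M {A} oa@(b₁ , _) ≢top with any? (λ c → level c ℕ.≟ M) A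
... | yes full = ⊥-elim (≢top (cong sortℕ (full-column⇒levels≡ r₀ 2≤M oa full)))
... | no ¬full = All.zipWith (λ (c≤M , c≢M) → ≤∧≢⇒< c≤M c≢M)
                   (All.map (λ {c} → level≤runs c r₀) b₁ , All.¬Any⇒All¬ A ¬full)

params-identityColumn : ∀ {N} → 2 ≤ N → params (identityColumn N ∷ []) ≡ top N
params-identityColumn {N} 2≤N = cong sortℕ (levels-∷-accept (identityColumn N) [] 2≤N)

top-realized : ∀ {N} → 2 ≤ N → Realized N (top N)
top-realized {N} 2≤N = identityColumn N ∷ [] , IsOA′⇒IsOA (IsOA′-identityColumn N) , params-identityColumn 2≤N

dominated-by-top : ∀ {N} → 2 ≤ N → {B : Array N} → IsOA′ B → Dominated N (params B) (top N)
dominated-by-top {N} 2≤N {B} oa-B =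
  identityColumn N ∷ [] , IsOA′⇒IsOA (IsOA′-identityColumn N) , params-identityColumn 2≤N ,
  replaceCol (identityColumn N) B ++ [] , same-params , repl [] (identityColumn N) [] B (IsOA′⇒IsOA oa-B) ◅ ε
  where
    same-params : params (replaceCol (identityColumn N) B ++ []) ≡ params B
    same-params = trans (cong (sortℕ ∘ levels) (++-identityʳ (replaceCol (identityColumn N) B)))
                        (cong sortℕ (levels-replaceCol (identityColumn N) B))

-- Exhaustive search over orthogonal arrays

HasMaxima : Set → Set
HasMaxima X = ∀ (v : X → ℕ) → ∃[ x ] ∀ y → v y ≤ v x

Fin-hasMaxima : ∀ n → HasMaxima (Fin (suc n))
Fin-hasMaxima zero    v = zero , λ { zero → ≤-refl }
Fin-hasMaxima (suc n) v with Fin-hasMaxima n (v ∘ suc)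
... | i , max-i with ≤-total (v zero) (v (suc i))
...   | inj₁ v₀≤ = suc i , λ { zero → v₀≤ ; (suc j) → max-i j }
...   | inj₂ ≤v₀ = zero  , λ { zero → ≤-refl ; (suc j) → ≤-trans (max-i j) ≤v₀ }

Σ-hasMaxima : ∀ {A : Set} {B : A → Set} → HasMaxima A → (∀ a → HasMaxima (B a)) → HasMaxima (Σ A B)
Σ-hasMaxima {A} {B} max-A max-B v =
  (a* , best a*) , λ (a , b) → ≤-trans (proj₂ (max-B a (v ∘ (a ,_))) b) (proj₂ (max-A (λ a → v (a , best a))) a)
  where
    best : ∀ a → B a
    best a = proj₁ (max-B a (v ∘ (a ,_)))
    a* : A
    a* = proj₁ (max-A (λ a → v (a , best a)))

Vec-hasMaxima : ∀ {X : Set} → HasMaxima X → ∀ n → HasMaxima (Vec X n)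
Vec-hasMaxima max-X zero    v = [] , λ { [] → ≤-refl }
Vec-hasMaxima max-X (suc n) v =
  let (x , xs) , max = Σ-hasMaxima max-X (λ _ → Vec-hasMaxima max-X n) (λ (x , xs) → v (x ∷ xs))
  in x ∷ xs , λ { (y ∷ ys) → max (y , ys) }

List≤ : Set → ℕ → Set
List≤ X K = Σ (List X) λ xs → length xs ≤ K

List≤-hasMaxima : ∀ {X : Set} → HasMaxima X → ∀ K → HasMaxima (List≤ X K)
List≤-hasMaxima max-X zero    v = ([] , z≤n) , λ { ([] , z≤n) → ≤-refl }
List≤-hasMaxima max-X (suc K) v
  with Σ-hasMaxima max-X (λ _ → List≤-hasMaxima max-X K) (λ (x , xs , len) → v (x ∷ xs , s≤s len))
... | (x , xs , len) , max-∷ with ≤-total (v ([] , z≤n)) (v (x ∷ xs , s≤s len))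
...   | inj₁ []≤ = (x ∷ xs , s≤s len) , λ { ([] , z≤n)            → []≤
                                        ; (y ∷ ys , s≤s len′) → max-∷ (y , ys , len′) }
...   | inj₂ ≤[] = ([] , z≤n) , λ { ([] , z≤n)            → ≤-refl
                                ; (y ∷ ys , s≤s len′) → ≤-trans (max-∷ (y , ys , len′)) ≤[] }

ColumnCode : ℕ → Set
ColumnCode N = Σ (Fin (suc N)) λ l → Vec (Fin (suc (toℕ l))) N

ColumnCode-hasMaxima : ∀ N → HasMaxima (ColumnCode N)
ColumnCode-hasMaxima N = Σ-hasMaxima (Fin-hasMaxima N) (λ l → Vec-hasMaxima (Fin-hasMaxima (toℕ l)) N)

decode : ∀ {N} → ColumnCode N → Column N
decode (l , v) = mkCol (suc (toℕ l)) (Vec.lookup v)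

-- Columns store functions, so without function extensionality a decoded column agrees with
-- the column it codes only up to ≈ᶜ.
infix 4 _≈ᶜ_
_≈ᶜ_ : ∀ {N} → Column N → Column N → Set
c ≈ᶜ d = level c ≡ level d × (∀ r → toℕ (entries c r) ≡ toℕ (entries d r))

≈ᶜ-sym : ∀ {N} {c d : Column N} → c ≈ᶜ d → d ≈ᶜ c
≈ᶜ-sym (l≡ , e≡) = sym l≡ , sym ∘ e≡

encode : ∀ {N} (c : Column N) → 1 ≤ level c → level c ≤ N → ∃[ x ] decode x ≈ᶜ c
encode {N} (mkCol (suc k) f) (s≤s z≤n) k<N =
  (l , tabulate (cast k≡l ∘ f)) , sym k≡l ,
  λ r → trans (cong toℕ (lookup∘tabulate (cast k≡l ∘ f) r)) (toℕ-cast k≡l (f r))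
  where
    l : Fin (suc N)
    l = fromℕ< (m<n⇒m<1+n k<N)
    k≡l : suc k ≡ suc (toℕ l)
    k≡l = cong suc (sym (toℕ-fromℕ< (m<n⇒m<1+n k<N)))

≈ᶜ-carries : ∀ {N L} {f g : Fin N → Fin L} → mkCol L f ≈ᶜ mkCol L g →
  ∀ x r → carries (mkCol L f) x r ≡ carries (mkCol L g) x r
≈ᶜ-carries (_ , f≗g) x r = cong (λ y → does (y ≟ x)) (toℕ-injective (f≗g r))

≈ᶜ-balanced₁ : ∀ {N} {c d : Column N} → c ≈ᶜ d → Balanced₁ c → Balanced₁ d
≈ᶜ-balanced₁ {c = mkCol L f} {mkCol .L g} c≈d@(refl , _) bc a a′ =
  trans (sym (count-cong (≈ᶜ-carries c≈d a))) (trans (bc a a′) (count-cong (≈ᶜ-carries c≈d a′)))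

≈ᶜ-balanced₂ : ∀ {N} {c d c′ d′ : Column N} → c ≈ᶜ d → c′ ≈ᶜ d′ → Balanced₂ c c′ → Balanced₂ d d′
≈ᶜ-balanced₂ {c = mkCol L f} {mkCol .L g} {mkCol L′ f′} {mkCol .L′ g′} c≈d@(refl , _) c′≈d′@(refl , _) bcc′ a a′ b b′ =
  trans (sym (count-cong (λ r → cong₂ _∧_ (≈ᶜ-carries c≈d a r) (≈ᶜ-carries c′≈d′ b r))))
  (trans (bcc′ a a′ b b′) (count-cong (λ r → cong₂ _∧_ (≈ᶜ-carries c≈d a′ r) (≈ᶜ-carries c′≈d′ b′ r))))

≈ᶜ-IsOA′ : ∀ {N} {A B : Array N} → Pointwise _≈ᶜ_ A B → IsOA′ A → IsOA′ B
≈ᶜ-IsOA′ []           _                      = [] , []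
≈ᶜ-IsOA′ (_∷_ {x = c} {y = d} c≈d A≈B) (bc ∷ b₁ , bc-A ∷ b₂) =
  let b₁′ , b₂′ = ≈ᶜ-IsOA′ A≈B (b₁ , b₂)
  in ≈ᶜ-balanced₁ {c = c} {d} c≈d bc ∷ b₁′ , transport A≈B bc-A ∷ b₂′
  where
    transport : ∀ {A B} → Pointwise _≈ᶜ_ A B → All (Balanced₂ c) A → All (Balanced₂ d) B
    transport []            []          = []
    transport (_∷_ {x = c′} {y = d′} c′≈d′ A≈B) (bcc′ ∷ bs) =
      ≈ᶜ-balanced₂ {c = c} {d} {c′} {d′} c≈d c′≈d′ bcc′ ∷ transport A≈B bs

≈ᶜ-map-level : ∀ {N} {A B : Array N} → Pointwise _≈ᶜ_ A B → map level A ≡ map level B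
≈ᶜ-map-level A≈B = Pointwise-≡⇒≡ (Pointwise.map⁺ level level (Pointwise.map proj₁ A≈B))

encode-array : ∀ {N} (A : Array N) → All (λ c → 1 ≤ level c × level c ≤ N) A →
  ∃[ xs ] Pointwise _≈ᶜ_ (map decode xs) A
encode-array []      []                 = [] , []
encode-array (c ∷ A) ((1≤c , c≤N) ∷ bounds) =
  let x , x≈c = encode c 1≤c c≤N
      xs , xs≈A = encode-array A bounds
  in x ∷ xs , x≈c ∷ xs≈A

-- Distinct non-constant columns of an orthogonal array are not ≈ᶜ (balanced₂⇒¬≗), so coding a
-- column by its entries is injective.
length≤runs^runs : ∀ {N} {A : Array N} → Fin N → IsOA′ A → All (λ c → 2 ≤ level c) A → length A ≤ N ^ N
length≤runs^runs {N} {A} r₀ (b₁ , b₂) nonconstant = injective⇒≤ {f = code} injective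
  where
    column : Fin (length A) → Column N
    column = lookup A
    widened : ∀ i → Fin N → Fin N
    widened i r = inject≤ (entries (column i) r) (level≤runs (column i) r₀ (All.lookup b₁ (∈-lookup i)))
    code : Fin (length A) → Fin (N ^ N)
    code i = funToFin (widened i)
    same-entries : ∀ {i j} → code i ≡ code j →
                   ∀ r → toℕ (entries (column i) r) ≡ toℕ (entries (column j) r)
    same-entries {i} {j} eq r = begin
      toℕ (entries (column i) r)  ≡⟨ sym (toℕ-inject≤ _ _) ⟩
      toℕ (widened i r)           ≡⟨ cong toℕ (sym (finToFun-funToFin (widened i) r)) ⟩
      toℕ (finToFun (code i) r) ≡⟨ cong (λ k → toℕ (finToFun k r)) eq ⟩
      toℕ (finToFun (code j) r) ≡⟨ cong toℕ (finToFun-funToFin (widened j) r) ⟩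
      toℕ (widened j r)           ≡⟨ toℕ-inject≤ _ _ ⟩
      toℕ (entries (column j) r)  ∎
      where open ≡-Reasoning
    injective : ∀ {i j} → code i ≡ code j → i ≡ j
    injective {i} {j} eq with i ≟ j
    ... | yes i≡j = i≡j
    ... | no  i≢j = ⊥-elim (balanced₂⇒¬≗ (column i) (column j) r₀
                      (AllPairs⇒lookup (λ {c} {d} → balanced₂-sym {c = c} {d}) b₂ i j i≢j)
                      (All.lookup nonconstant (∈-lookup j)) (same-entries eq))

arrayOf : ∀ {N K} → List≤ (ColumnCode N) K → Array N
arrayOf (xs , _) = map decode xs

encode-OA : ∀ {N} → Fin N → (A : Array N) → IsOA′ A → LevelsBelow N A →
  Σ (List≤ (ColumnCode N) (N ^ N)) λ x →
    (IsOA′ (arrayOf x) × LevelsBelow N (arrayOf x)) × levels (arrayOf x) ≡ levels A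
encode-OA {N} r₀ A (b₁ , b₂) below =
  (xs , length≤) , (≈ᶜ-IsOA′ (symmetric ≈ᶜ-sym xs≈A₀) oa₀ , below-xs) ,
  trans (cong (filter (2 ≤?_)) (≈ᶜ-map-level xs≈A₀)) (levels-nonconstant A)
  where
    A₀ : Array N
    A₀ = filter nonconstant? A
    oa₀ : IsOA′ A₀
    oa₀ = All.filter⁺ nonconstant? b₁ , AllPairs.filter⁺ nonconstant? b₂
    below₀ : LevelsBelow N A₀
    below₀ = All.filter⁺ nonconstant? below
    bounds : All (λ c → 1 ≤ level c × level c ≤ N) A₀
    bounds = All.zipWith (λ (2≤c , c<N) → ≤-trans (s≤s z≤n) 2≤c , <⇒≤ c<N)
                         (All.all-filter nonconstant? A , below₀)
    xs : List (ColumnCode N)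
    xs = proj₁ (encode-array A₀ bounds)
    xs≈A₀ : Pointwise _≈ᶜ_ (map decode xs) A₀
    xs≈A₀ = proj₂ (encode-array A₀ bounds)
    length≤ : length xs ≤ N ^ N
    length≤ = subst (_≤ N ^ N) (trans (sym (Pointwise-length xs≈A₀)) (length-map decode xs))
                (length≤runs^runs r₀ oa₀ (All.all-filter nonconstant? A))
    below-xs : LevelsBelow N (map decode xs)
    below-xs = All.map⁻ (subst (All (_< N)) (sym (≈ᶜ-map-level xs≈A₀)) (All.map⁺ below₀))

-- Search all codes of at most N^N columns; a code that does not decode to an orthogonal array
-- with levels below N is scored as the empty array.
levels-argmax : ∀ N → Fin N → (V : List ℕ → ℕ) →
  Σ (Array N) λ B → (IsOA′ B × LevelsBelow N B) ×
                    (∀ (A : Array N) → IsOA′ A → LevelsBelow N A → V (levels A) ≤ V (levels B))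
levels-argmax N r₀ V = candidate x* (valid? x*) , candidate-valid x* (valid? x*) , bound
  where
    Valid : List≤ (ColumnCode N) (N ^ N) → Set
    Valid x = IsOA′ (arrayOf x) × LevelsBelow N (arrayOf x)
    valid? : ∀ x → Dec (Valid x)
    valid? x = IsOA′? (arrayOf x) ×-dec All.all? (λ c → level c <? N) (arrayOf x)
    candidate : ∀ x → Dec (Valid x) → Array N
    candidate x (yes _) = arrayOf x
    candidate x (no _)  = []
    candidate-valid : ∀ x (d : Dec (Valid x)) → IsOA′ (candidate x d) × LevelsBelow N (candidate x d)
    candidate-valid x (yes valid) = valid
    candidate-valid x (no _)      = ([] , []) , []
    candidate-array : ∀ x → Valid x → candidate x (valid? x) ≡ arrayOf x
    candidate-array x valid with valid? x
    ... | yes _      = refl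
    ... | no  ¬valid = contradiction valid ¬valid
    score : List≤ (ColumnCode N) (N ^ N) → ℕ
    score x = V (levels (candidate x (valid? x)))
    x* : List≤ (ColumnCode N) (N ^ N)
    x* = proj₁ (List≤-hasMaxima (ColumnCode-hasMaxima N) (N ^ N) score)
    bound : ∀ A → IsOA′ A → LevelsBelow N A → V (levels A) ≤ score x*
    bound A oa below =
      let x , valid , same = encode-OA r₀ A oa below
      in subst (_≤ score x*) (cong V (trans (cong levels (candidate-array x valid)) same))
               (proj₂ (List≤-hasMaxima (ColumnCode-hasMaxima N) (N ^ N) score) x)

-- Heights

HeightFormula : ℕ → Set
HeightFormula N = ∃[ h ] (Ht N h × ∃[ m ] (IsMaxSumHt N m × h ≡ suc m))

Ht-unique : ∀ {s h h′} → Ht s h → Ht s h′ → h ≡ h′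
Ht-unique (path , longest) (path′ , longest′) = ≤-antisym (longest′ _ path) (longest _ path′)

module HeightRecursion (N : ℕ) (2≤N : 2 ≤ N) (ih : ∀ s → 2 ≤ s → s < N → HeightFormula s) where

  r₀ : Fin N
  r₀ = fromℕ< (≤-trans (s≤s z≤n) 2≤N)

  InRange : ℕ → Set
  InRange s = 2 ≤ s × s < N

  -- The height of Λ_s for 2 ≤ s < N, and 0 elsewhere.
  ht : ℕ → ℕ
  ht s with 2 ≤? s | s <? N
  ... | yes 2≤s | yes s<N = proj₁ (ih s 2≤s s<N)
  ... | _       | _       = 0

  ht-formula : ∀ {s} → InRange s → Ht s (ht s) × ∃[ m ] (IsMaxSumHt s m × ht s ≡ suc m)
  ht-formula {s} (2≤s , s<N) with 2 ≤? s | s <? N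
  ... | yes 2≤s′ | yes s<N′ = proj₂ (ih s 2≤s′ s<N′)
  ... | no  2≰s  | _        = contradiction 2≤s 2≰s
  ... | yes _    | no  s≮N  = contradiction s<N s≮N

  weight : ParamSet → ℕ
  weight P = sum (map ht P)

  weight-++ : ∀ P Q → weight (P ++ Q) ≡ weight P + weight Q
  weight-++ P Q = trans (cong sum (map-++ ht P Q)) (sum-++ (map ht P) (map ht Q))

  weight-params : ∀ {S} (A : Array S) → weight (params A) ≡ weight (levels A)
  weight-params A = sum-↭ (↭.map⁺ ht (MergeSort.sort-↭ ≤-decTotalOrder (levels A)))

  SumHt⇒≡weight : ∀ {P m} → All InRange P → SumHt P m → m ≡ weight P
  SumHt⇒≡weight []             []         = refl
  SumHt⇒≡weight (s∈ ∷ P∈) (hₛ ∷ sums) =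
    cong₂ _+_ (Ht-unique hₛ (proj₁ (ht-formula s∈))) (SumHt⇒≡weight P∈ sums)

  SumHt-weight : ∀ {P} → All InRange P → SumHt P (weight P)
  SumHt-weight []        = []
  SumHt-weight (s∈ ∷ P∈) = proj₁ (ht-formula s∈) ∷ SumHt-weight P∈

  params-inRange : ∀ {S} {A : Array S} → S ≤ N → LevelsBelow S A → All InRange (params A)
  params-inRange S≤N below = All.map (λ (2≤s , s<S) → 2≤s , ≤-trans s<S S≤N) (All-params below)

  realized-inRange : ∀ {P} → Realized N P → P ≢ top N → All InRange P
  realized-inRange (A , isOA , refl) P≢top =
    params-inRange ≤-refl (params≢top⇒levels<runs r₀ 2≤N (IsOA⇒IsOA′ isOA) P≢top)

  infix 4 _⊑_
  _⊑_ : ParamSet → ParamSet → Set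
  P ⊑ Q = P ≡ Q ⊎ weight P < weight Q

  ⊑-trans : ∀ {P Q R} → P ⊑ Q → Q ⊑ R → P ⊑ R
  ⊑-trans (inj₁ refl) Q⊑R         = Q⊑R
  ⊑-trans (inj₂ P<Q)  (inj₁ refl) = inj₂ P<Q
  ⊑-trans (inj₂ P<Q)  (inj₂ Q<R)  = inj₂ (<-trans P<Q Q<R)

  weight-infix : ∀ (pre ys post : Array N) →
    weight (params (pre ++ ys ++ post)) ≡ weight (levels pre) + (weight (levels ys) + weight (levels post))
  weight-infix pre ys post = begin
    weight (params (pre ++ ys ++ post))                  ≡⟨ weight-params (pre ++ ys ++ post) ⟩
    weight (levels (pre ++ ys ++ post))                  ≡⟨ cong weight (levels-infix pre ys post) ⟩
    weight (levels pre ++ levels ys ++ levels post)      ≡⟨ weight-++ (levels pre) _ ⟩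
    weight (levels pre) + weight (levels ys ++ levels post)
      ≡⟨ cong (weight (levels pre) +_) (weight-++ (levels ys) _) ⟩
    weight (levels pre) + (weight (levels ys) + weight (levels post)) ∎
    where open ≡-Reasoning

  weight-replace : ∀ (pre : Array N) (c : Column N) (post : Array N) (B : Array (level c)) →
    weight (params (pre ++ replaceCol c B ++ post)) ≡ weight (levels pre) + (weight (levels B) + weight (levels post))
  weight-replace pre c post B =
    trans (weight-infix pre (replaceCol c B) post)
          (cong (λ L → weight (levels pre) + (weight L + weight (levels post))) (levels-replaceCol c B))

  infix-⊑ : ∀ (pre : Array N) {xs ys : Array N} (post : Array N) →
    levels ys ≡ levels xs ⊎ weight (levels ys) < weight (levels xs) →
    params (pre ++ ys ++ post) ⊑ params (pre ++ xs ++ post)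
  infix-⊑ pre {xs} {ys} post (inj₁ same) =
    inj₁ (cong sortℕ (trans (levels-infix pre ys post)
                     (trans (cong (λ L → levels pre ++ L ++ levels post) same) (sym (levels-infix pre xs post)))))
  infix-⊑ pre {xs} {ys} post (inj₂ lighter) =
    inj₂ (subst₂ _<_ (sym (weight-infix pre ys post)) (sym (weight-infix pre xs post))
           (+-monoʳ-< (weight (levels pre)) (+-monoˡ-< (weight (levels post)) lighter)))

  -- By the formula for s = level c < N, weight B ≤ ht s − 1 unless params B = (s, s¹).
  replacement-lighter : ∀ (c : Column N) {B : Array (level c)} → level c < N → IsOA′ B →
    levels B ≡ levels (c ∷ []) ⊎ weight (levels B) < weight (levels (c ∷ []))
  replacement-lighter c {B} c<N oaB@(b₁B , _) with 2 ≤? level c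
  ... | no 2≰c =
    let c≤1 = ≮⇒≥ 2≰c
    in inj₁ (trans (levels-constant (All.map (λ {d} bd → ≤-trans (level≤runs d (entries c r₀) bd) c≤1) b₁B))
                   (sym (levels-∷-reject c [] c≤1)))
  ... | yes 2≤c with ≡-dec ℕ._≟_ (params B) (top (level c))
  ...   | yes full =
    let levels↭ = subst (_↭ levels B) full (MergeSort.sort-↭ ≤-decTotalOrder (levels B))
    in inj₁ (trans (↭.↭-singleton-inv (↭-sym levels↭)) (sym (levels-∷-accept c [] 2≤c)))
  ...   | no ¬full =
    let m , (_ , heaviest) , ht≡ = proj₂ (ht-formula (2≤c , c<N))
        B-inRange = params-inRange (<⇒≤ c<N) (params≢top⇒levels<runs (entries c r₀) 2≤c oaB ¬full)
        B≤m = heaviest (params B) _ (B , IsOA′⇒IsOA oaB , refl) ¬full (SumHt-weight B-inRange)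
    in inj₂ (begin-strict
      weight (levels B)           ≡⟨ sym (weight-params B) ⟩
      weight (params B)           ≤⟨ B≤m ⟩
      m                           <⟨ ≤-refl ⟩
      suc m                       ≡⟨ sym ht≡ ⟩
      ht (level c)                ≡⟨ sym (+-identityʳ _) ⟩
      weight (level c ∷ [])       ≡⟨ cong weight (sym (levels-∷-accept c [] 2≤c)) ⟩
      weight (levels (c ∷ []))    ∎)
    where open ≤-Reasoning

  expansive-step : ∀ (pre : Array N) {c : Column N} (post : Array N) {B : Array (level c)} →
    IsOA′ (pre ++ c ∷ post) → LevelsBelow N (pre ++ c ∷ post) → IsOA′ B →
    let A′ = pre ++ replaceCol c B ++ post in
    IsOA′ A′ × LevelsBelow N A′ × params A′ ⊑ params (pre ++ c ∷ post)
  expansive-step pre {c} post {B} oa below oaB@(b₁B , _) with All.++⁻ʳ pre below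
  ... | c<N ∷ _ =
    IsOA′-replace pre {c} oa oaB ,
    All-replace pre below (All.map⁺ (All.map (λ {d} bd → ≤-<-trans (level≤runs d (entries c r₀) bd) c<N) b₁B)) ,
    infix-⊑ pre post (subst (λ L → L ≡ levels (c ∷ []) ⊎ weight L < weight (levels (c ∷ [])))
                            (sym (levels-replaceCol c B)) (replacement-lighter c c<N oaB))

  replacements-descend : ∀ {A A′ : Array N} → Star ExpRepl A A′ → IsOA′ A → LevelsBelow N A →
    IsOA′ A′ × LevelsBelow N A′ × params A′ ⊑ params A
  replacements-descend ε oa below = oa , below , inj₁ refl
  replacements-descend (repl pre c post B isOA-B ◅ rest) oa below =
    let oa₁ , below₁ , A₁⊑A  = expansive-step pre post oa below (IsOA⇒IsOA′ isOA-B)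
        oa₂ , below₂ , A₂⊑A₁ = replacements-descend rest oa₁ below₁
    in oa₂ , below₂ , ⊑-trans A₂⊑A₁ A₁⊑A

  dominated-descends : ∀ {P Q} → Dominated N P Q → Q ≢ top N → P ≢ top N × P ⊑ Q
  dominated-descends (A , isOA , refl , A′ , refl , replacements) Q≢top =
    let oa = IsOA⇒IsOA′ isOA
        _ , below′ , A′⊑A = replacements-descend replacements oa (params≢top⇒levels<runs r₀ 2≤N oa Q≢top)
    in params≢top below′ , A′⊑A

  path-length≤weight : ∀ {Q n} → DownPath N Q n → Q ≢ top N → n ≤ weight Q
  path-length≤weight atBottom _ = z≤n
  path-length≤weight (step (_ , _ , P≼Q , P≢Q , _) path) Q≢top with dominated-descends P≼Q Q≢top
  ... | _     , inj₁ P≡Q = contradiction P≡Q P≢Q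
  ... | P≢top , inj₂ P<Q = ≤-trans (s≤s (path-length≤weight path P≢top)) P<Q

  covers-if-heaviest-below : ∀ {P Q} → Realized N P → Realized N Q → Dominated N P Q → P ≢ Q →
    (∀ R → Realized N R → R ≢ Q → Dominated N R Q → weight R ≤ weight P) → Covers N P Q
  covers-if-heaviest-below {P} {Q} P-real Q-real P≼Q P≢Q heaviest = P-real , Q-real , P≼Q , P≢Q , between
    where
      R≢top : ∀ {R} → R ≢ Q → Dominated N R Q → R ≢ top N
      R≢top R≢Q R≼Q with ≡-dec ℕ._≟_ Q (top N)
      ... | yes refl  = R≢Q
      ... | no Q≢top = proj₁ (dominated-descends R≼Q Q≢top)
      between : ∀ R → Realized N R → Dominated N P R → Dominated N R Q → R ≡ P ⊎ R ≡ Q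
      between R R-real P≼R R≼Q with ≡-dec ℕ._≟_ R Q
      ... | yes R≡Q = inj₂ R≡Q
      ... | no  R≢Q with dominated-descends P≼R (R≢top R≢Q R≼Q)
      ...   | _ , inj₁ P≡R = inj₁ (sym P≡R)
      ...   | _ , inj₂ P<R = contradiction (heaviest R R-real R≢Q R≼Q) (<⇒≱ P<R)

  heaviest-replacement : ∀ (c : Column N) → 2 ≤ level c → level c < N →
    Σ (Array (level c)) λ B → IsOA′ B × suc (weight (levels B)) ≡ weight (levels (c ∷ []))
  heaviest-replacement c 2≤c c<N =
    let m , ((P , (B , isOA-B , B↦P) , P≢top , sums) , _) , ht≡ = proj₂ (ht-formula (2≤c , c<N))
        oa-B = IsOA⇒IsOA′ isOA-B
        B≢top = P≢top ∘ trans (sym B↦P)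
        B-inRange = params-inRange (<⇒≤ c<N) (params≢top⇒levels<runs (entries c r₀) 2≤c oa-B B≢top)
        m≡ = SumHt⇒≡weight B-inRange (subst (λ P → SumHt P m) (sym B↦P) sums)
    in B , oa-B , (begin
      suc (weight (levels B))  ≡⟨ cong suc (sym (weight-params B)) ⟩
      suc (weight (params B))  ≡⟨ cong suc (sym m≡) ⟩
      suc m                    ≡⟨ sym ht≡ ⟩
      ht (level c)             ≡⟨ sym (+-identityʳ _) ⟩
      weight (level c ∷ [])    ≡⟨ cong weight (sym (levels-∷-accept c [] 2≤c)) ⟩
      weight (levels (c ∷ [])) ∎)
    where open ≡-Reasoning

  one-lighter : ∀ (pre : Array N) (c : Column N) (post : Array N) → 2 ≤ level c →
    IsOA′ (pre ++ c ∷ post) → LevelsBelow N (pre ++ c ∷ post) →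
    Σ (Array N) λ A′ → IsOA′ A′ × LevelsBelow N A′ × Covers N (params A′) (params (pre ++ c ∷ post)) ×
                       weight (params (pre ++ c ∷ post)) ≡ suc (weight (params A′))
  one-lighter pre c post 2≤c oa below with All.++⁻ʳ pre below
  ... | c<N ∷ _ with heaviest-replacement c 2≤c c<N
  ...   | B , oa-B , B≡c-1 = A′ , oa′ , below′ , A′⋖A , w≡
    where
      A A′ : Array N
      A  = pre ++ c ∷ post
      A′ = pre ++ replaceCol c B ++ post
      oa′ : IsOA′ A′
      oa′ = proj₁ (expansive-step pre post oa below oa-B)
      below′ : LevelsBelow N A′
      below′ = proj₁ (proj₂ (expansive-step pre post oa below oa-B))
      w≡ : weight (params A) ≡ suc (weight (params A′))
      w≡ = begin
        weight (params A)
          ≡⟨ weight-infix pre (c ∷ []) post ⟩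
        weight (levels pre) + (weight (levels (c ∷ [])) + weight (levels post))
          ≡⟨ cong (λ w → weight (levels pre) + (w + weight (levels post))) (sym B≡c-1) ⟩
        weight (levels pre) + suc (weight (levels B) + weight (levels post))
          ≡⟨ +-suc (weight (levels pre)) _ ⟩
        suc (weight (levels pre) + (weight (levels B) + weight (levels post)))
          ≡⟨ cong suc (sym (weight-replace pre c post B)) ⟩
        suc (weight (params A′))
          ∎
        where open ≡-Reasoning
      heaviest : ∀ R → Realized N R → R ≢ params A → Dominated N R (params A) → weight R ≤ weight (params A′)
      heaviest R _ R≢A R≼A with dominated-descends R≼A (params≢top below)
      ... | _ , inj₁ R≡A = contradiction R≡A R≢A
      ... | _ , inj₂ R<A = ≤-pred (subst (weight R <_) w≡ R<A)
      A′⋖A : Covers N (params A′) (params A)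
      A′⋖A = covers-if-heaviest-below (A′ , IsOA′⇒IsOA oa′ , refl) (A , IsOA′⇒IsOA oa , refl)
               (A , IsOA′⇒IsOA oa , refl , A′ , refl , repl pre c post B (IsOA′⇒IsOA oa-B) ◅ ε)
               (λ A′≡A → 1+n≢n (trans (sym w≡) (sym (cong weight A′≡A))))
               heaviest

  descent-path : ∀ n (A : Array N) → IsOA′ A → LevelsBelow N A →
    weight (params A) ≡ n → DownPath N (params A) n
  descent-path n A oa below w≡n with nonconstant-split A
  ... | inj₁ constant = subst₂ (DownPath N) (sym params≡[]) (trans (sym (cong weight params≡[])) w≡n) atBottom
    where
      params≡[] : params A ≡ []
      params≡[] = cong sortℕ (levels-constant constant)
  descent-path zero    .(pre ++ c ∷ post) oa below w≡0 | inj₂ (pre , c , post , refl , 2≤c) =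
    let _ , _ , _ , _ , w≡ = one-lighter pre c post 2≤c oa below
    in contradiction (trans (sym w≡0) w≡) 0≢1+n
  descent-path (suc n) .(pre ++ c ∷ post) oa below w≡n | inj₂ (pre , c , post , refl , 2≤c) =
    let A′ , oa′ , below′ , A′⋖A , w≡ = one-lighter pre c post 2≤c oa below
    in step A′⋖A (descent-path n A′ oa′ below′ (suc-injective (trans (sym w≡) w≡n)))

  argmax : Σ (Array N) λ B → (IsOA′ B × LevelsBelow N B) ×
    (∀ (A : Array N) → IsOA′ A → LevelsBelow N A → weight (params A) ≤ weight (params B))
  argmax = levels-argmax N r₀ (weight ∘ sortℕ)

  B* : Array N
  B* = proj₁ argmax

  B*-isOA : IsOA′ B*
  B*-isOA = proj₁ (proj₁ (proj₂ argmax))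

  B*-below : LevelsBelow N B*
  B*-below = proj₂ (proj₁ (proj₂ argmax))

  maxWeight : ℕ
  maxWeight = weight (params B*)

  weight≤maxWeight : ∀ {P} → Realized N P → P ≢ top N → weight P ≤ maxWeight
  weight≤maxWeight (A , isOA , refl) P≢top =
    let oa = IsOA⇒IsOA′ isOA in proj₂ (proj₂ argmax) A oa (params≢top⇒levels<runs r₀ 2≤N oa P≢top)

  maxWeight-isMax : IsMaxSumHt N maxWeight
  maxWeight-isMax =
    (params B* , (B* , IsOA′⇒IsOA B*-isOA , refl) , params≢top B*-below ,
                 SumHt-weight (params-inRange ≤-refl B*-below)) ,
    λ P m P-real P≢top sums → subst (_≤ maxWeight) (sym (SumHt⇒≡weight (realized-inRange P-real P≢top) sums))
                                    (weight≤maxWeight P-real P≢top)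

  top-covers-heaviest : Covers N (params B*) (top N)
  top-covers-heaviest =
    covers-if-heaviest-below (B* , IsOA′⇒IsOA B*-isOA , refl) (top-realized 2≤N) (dominated-by-top 2≤N B*-isOA)
      (params≢top B*-below) (λ R R-real R≢top _ → weight≤maxWeight R-real R≢top)

  formula : HeightFormula N
  formula = suc maxWeight , (longest-path , longest) , maxWeight , maxWeight-isMax , refl
    where
      longest-path : DownPath N (top N) (suc maxWeight)
      longest-path = step top-covers-heaviest
                       (descent-path maxWeight B* B*-isOA B*-below refl)
      longest : ∀ n → DownPath N (top N) n → n ≤ suc maxWeight
      longest .(suc _) (step (P-real , _ , _ , P≢top , _) path) =
        s≤s (≤-trans (path-length≤weight path P≢top) (weight≤maxWeight P-real P≢top))

lemma2 : ∀ (N : ℕ) → 2 ≤ N →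
    ∃[ h ] (Ht N h × ∃[ m ] (IsMaxSumHt N m × h ≡ suc m))
lemma2 = <-rec (λ N → 2 ≤ N → HeightFormula N)
  λ N ih 2≤N → HeightRecursion.formula N 2≤N (λ s 2≤s s<N → ih s<N 2≤s)
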